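{- Let $n\ge1$, $m\ge0$, $k\ge0$ be integers and $T\in\mathrm{pRInc}^m_k(2\times n)$. Then \[ \mathrm{maj}(g(T))=\begin{cases}\mathrm{amaj}(T)+n-k, & \text{if } T_{1,1}=T_{2,1},\\ \mathrm{amaj}(T)+m+n-k, & \text{if } T_{1,1}\ne T_{2,1}.\end{cases} \]
   Context: $\mathrm{RInc}^m_k(2\times n)$ denotes the set of $2\times n$ arrays $T=(T_{i,j})$ (row 1 on top) of positive integers with strictly increasing rows, weakly increasing columns ($T_{1,j}\le T_{2,j}$), and set of entries exactly $\{m+1,\ldots,m+2n-k\}$. Such a $T$ is prime if for every $j$ with $1\le j\le n-1$ and $T_{1,j+1}=T_{2,j}+1$, the entry $T_{2,j+1}$ also appears in row 1 of $T$; $\mathrm{pRInc}^m_k(2\times n)$ is the set of prime arrays in $\mathrm{RInc}^m_k(2\times n)$. For $T$ prime let $A=\{a_1<\cdots<a_k\}$ be the set of numbers appearing twice in $T$, and for each $i$ let $b_i$ be the entry of row 2 immediately to the left of $a_i$ in row 2, read cyclically (if $a_i=T_{2,1}$ then $b_i=T_{2,n}$); let $B=\{b_1,\ldots,b_k\}$. $g(T)$ is the $2\times n$ array whose second row equals that of $T$ and whose first row consists of the entries of $(\text{row 1 of }T)\setminus A$ together with the elements of $B$, in increasing order. For a two-row array $S$, $i$ is a descent if $i$ occurs in row 1 and $i+1$ occurs in row 2, and an ascent if $i$ occurs in row 2 and $i+1$ occurs in row 1; $\mathrm{maj}(S)$ (resp. $\mathrm{amaj}(S)$) is the sum of the descents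 (resp. ascents) of $S$. -}

module Defs where

open import Data.Nat using (ℕ; zero; suc; _+_; _*_; _∸_; _≤_; _<_)
open import Data.Nat.Properties using (_≟_; ≤-decTotalOrder)
open import Data.Fin using (Fin; zero; suc; toℕ; fromℕ; inject₁)
import Data.Fin as F
open import Data.List using (List; []; _∷_; _++_; map; filter; deduplicate)
open import Data.Nat.ListAction using (sum)
import Data.List as L
open import Data.List.Membership.DecPropositional _≟_ using (_∈_; _∈?_)
open import Data.List.Sort ≤-decTotalOrder using (sort)
open import Data.Product using (_×_; _,_; ∃; proj₁; proj₂)
open import Relation.Nullary using (¬_; ¬?)
open import Relation.Binary.PropositionalEquality using (_≡_)
open import Function.Bundles using (_⇔_)

-- A 2 × n array of natural numbers; columns indexed 0,...,n-1 by Fin n.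
-- row1 = top row (T_{1,j+1} = row1 j), row2 = bottom row.
record Array (n : ℕ) : Set where
  constructor mkArray
  field
    row1 : Fin n → ℕ
    row2 : Fin n → ℕ
open Array public

InRow1 : ∀ {n} → Array n → ℕ → Set
InRow1 T x = ∃ λ j → row1 T j ≡ x

InRow2 : ∀ {n} → Array n → ℕ → Set
InRow2 T x = ∃ λ j → row2 T j ≡ x

Occurs : ∀ {n} → Array n → ℕ → Set
Occurs {n} T x = ∃ λ (i : Fin 2) → ∃ λ (j : Fin n) → entry i j ≡ x
  where
  entry : Fin 2 → Fin n → ℕ
  entry zero = row1 T
  entry (suc _) = row2 T

record RInc (m k n : ℕ) (T : Array n) : Set where
  field
    row1-strict : ∀ (i j : Fin n) → i F.< j → row1 T i < row1 T j
    row2-strict : ∀ (i j : Fin n) → i F.< j → row2 T i < row2 T j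
    col-weak    : ∀ (j : Fin n) → row1 T j ≤ row2 T j
    entries     : ∀ (x : ℕ) → Occurs T x ⇔ (m < x × x ≤ m + (2 * n ∸ k))

-- prime: for 1 ≤ j ≤ n-1 (here 0-indexed columns j, j' = j+1),
-- T_{1,j+1} = T_{2,j} + 1 implies T_{2,j+1} occurs in row 1.
IsPrime : ∀ {n} → Array n → Set
IsPrime {n} T = ∀ (j j' : Fin n) → toℕ j' ≡ suc (toℕ j) →
  row1 T j' ≡ row2 T j + 1 → InRow1 T (row2 T j')

record PRInc (m k n : ℕ) (T : Array n) : Set where
  field
    rinc  : RInc m k n T
    prime : IsPrime T

rowList1 : ∀ {n} → Array n → List ℕ
rowList1 T = L.tabulate (row1 T)

rowList2 : ∀ {n} → Array n → List ℕ
rowList2 T = L.tabulate (row2 T)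

prevCyc : ∀ {n} → Fin n → Fin n
prevCyc {suc n} zero = fromℕ n
prevCyc {suc n} (suc i) = inject₁ i

-- A: the numbers appearing twice in T (= entries of row 2 also in row 1)
setA : ∀ {n} → Array n → List ℕ
setA T = filter (λ x → x ∈? rowList1 T) (rowList2 T)

setB : ∀ {n} → Array n → List ℕ
setB {n} T =
  map (λ j → row2 T (prevCyc j))
      (filter (λ j → row2 T j ∈? setA T) (L.allFin n))

TwoRow : Set
TwoRow = List ℕ × List ℕ

toTwoRow : ∀ {n} → Array n → TwoRow
toTwoRow T = rowList1 T , rowList2 T

g : ∀ {n} → Array n → TwoRow
g T = sort (filter (λ x → ¬? (x ∈? setA T)) (rowList1 T) ++ setB T) , rowList2 T

-- maj: sum of descents i (i in row 1, i+1 in row 2), each i counted once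
maj : TwoRow → ℕ
maj (r1 , r2) = sum (filter (λ i → suc i ∈? r2) (deduplicate _≟_ r1))

-- amaj: sum of ascents i (i in row 2, i+1 in row 1), each i counted once
amaj : TwoRow → ℕ
amaj (r1 , r2) = sum (filter (λ i → suc i ∈? r1) (deduplicate _≟_ r2))

firstCol : ∀ {n} → 1 ≤ n → Fin n
firstCol {suc n} _ = zero

module Submission where

open import Defs
open import Data.Nat using (ℕ; zero; suc; _+_; _*_; _∸_; _≤_; _<_; _<?_; _≤?_; z≤n; s≤s; s≤s⁻¹; _≟_)
open import Data.Nat.Properties
open import Data.Nat.ListAction using (sum)
open import Data.Nat.Tactic.RingSolver using (solve-∀)
open import Algebra.Properties.CommutativeSemigroup +-commutativeSemigroup using (interchange; xy∙z≈xz∙y)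
open import Data.Bool as Bool using (Bool; true; false; _∧_; _∨_; not; T)
open import Data.Bool.Properties using (∧-identityʳ; ∧-zeroʳ)
open import Data.Empty using (⊥; ⊥-elim)
open import Data.Fin as F using (Fin; zero; suc; toℕ; fromℕ; inject₁)
open import Data.Fin.Properties
  using (toℕ-injective; toℕ-inject₁; ≤fromℕ; ≤̄⇒inject₁<; inject₁-injective; fromℕ≢inject₁)
open import Data.List using (List; []; _∷_; _++_; map; filter; deduplicate; length; allFin)
open import Data.List.Properties using (length-tabulate)
open import Data.List.Membership.DecPropositional _≟_ using (_∈_; _∉_; _∈?_)
open import Data.List.Membership.Propositional.Properties
  using ( ∈-filter⁺; ∈-filter⁻; ∈-map∘filter⁺; ∈-map∘filter⁻; ∈-tabulate⁺; ∈-tabulate⁻; ∈-allFin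
        ; ∈-++⁺ˡ; ∈-++⁺ʳ; ∈-++⁻; deduplicate-∈⇔; ∈-deduplicate⁻)
open import Data.List.Relation.Unary.All using (All; []; _∷_)
import Data.List.Relation.Unary.All as All
open import Data.List.Relation.Unary.AllPairs using ([]; _∷_)
open import Data.List.Relation.Unary.Unique.Propositional using (Unique)
open import Data.List.Relation.Unary.Unique.Propositional.Properties using (tabulate⁺)
open import Data.List.Relation.Unary.Unique.DecPropositional.Properties _≟_ using (deduplicate-!)
open import Data.List.Relation.Binary.Permutation.Propositional using (↭-sym)
open import Data.List.Relation.Binary.Permutation.Propositional.Properties using (∈-resp-↭)
open import Data.List.Sort ≤-decTotalOrder using (sort-↭)
open import Data.Product using (_×_; _,_; proj₁; proj₂; uncurry)
open import Data.Sum using (_⊎_; inj₁; inj₂)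
open import Function using (_∘_)
open import Function.Bundles using (_⇔_; mk⇔; module Equivalence)
open import Relation.Nullary using (¬_; Dec; does; yes; no; ¬?)
open import Relation.Nullary.Decidable using (_×-dec_; _⊎-dec_; dec-true; dec-false; does-⇔)
open import Relation.Unary using (Decidable)
open import Relation.Binary.Definitions using (tri<; tri≈; tri>)
open import Relation.Binary.PropositionalEquality
  using (_≡_; _≢_; refl; sym; trans; cong; cong₂; subst; module ≡-Reasoning)

open Equivalence using (to; from)

-- Let S be the set of entries occurring only in row 1. If i + 1 lies in row 2, then i lies in
-- row 1 of g(T) exactly when i ∈ S or i is an ascent of T, because B consists of the row-2
-- predecessors of the doubled entries. Hence maj(g(T)) − amaj(T) is the sum of the i ∈ S with
-- i + 1 in row 2, minus the sum of the i in row 2 with i + 1 ∈ S. The successor of an element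
-- of S lies in S or in row 2, and its predecessor lies in S, in row 2, or equals m (which
-- happens exactly when T₁₁ = m + 1 ∈ S, i.e. T₁₁ ≠ T₂₁). Telescoping the sums of s and s − 1
-- over S therefore gives maj(g(T)) − amaj(T) = |S| + m·[T₁₁ ≠ T₂₁], and |S| = n − k.

does-sound : ∀ {A : Set} (a? : Dec A) → T (does a?) → A
does-sound (yes a) _  = a
does-sound (no _)  ()

does-complete : ∀ {A : Set} (a? : Dec A) → A → T (does a?)
does-complete (yes _) _ = _
does-complete (no ¬a) a = ¬a a

infixr 7 [_]·_
[_]·_ : Bool → ℕ → ℕ
[ true  ]· x = x
[ false ]· x = 0

[]·-zeroʳ : ∀ b → [ b ]· 0 ≡ 0
[]·-zeroʳ true  = refl
[]·-zeroʳ false = refl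

[]·-∧ : ∀ a b x → [ a ∧ b ]· x ≡ [ a ]· [ b ]· x
[]·-∧ true  b x = refl
[]·-∧ false b x = refl

[]·-∨-disjoint : ∀ {a b} x → (T a → T b → ⊥) → [ a ∨ b ]· x ≡ [ a ]· x + [ b ]· x
[]·-∨-disjoint {true}  {true}  x a∩b = ⊥-elim (a∩b _ _)
[]·-∨-disjoint {true}  {false} x _   = sym (+-identityʳ x)
[]·-∨-disjoint {false} {_}     x _   = refl

[]·1-∨-split : ∀ a b → [ a ∧ not b ]· 1 + [ b ]· 1 ≡ [ a ∨ b ]· 1
[]·1-∨-split true  true  = refl
[]·1-∨-split true  false = refl
[]·1-∨-split false true  = refl
[]·1-∨-split false false = refl

[]·-not-∧-vanish : ∀ {a b} x → (T b → T a) → [ not a ∧ b ]· x ≡ 0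
[]·-not-∧-vanish {true}          x _   = refl
[]·-not-∧-vanish {false} {true}  x b⇒a = ⊥-elim (b⇒a _)
[]·-not-∧-vanish {false} {false} x _   = refl

∧-congʳ-T : ∀ {a b} c → (T c → a ≡ b) → a ∧ c ≡ b ∧ c
∧-congʳ-T {a} {b} true  a≡b = trans (∧-identityʳ a) (trans (a≡b _) (sym (∧-identityʳ b)))
∧-congʳ-T {a} {b} false _ = trans (∧-zeroʳ a) (sym (∧-zeroʳ b))

-- a, b record whether i lies in row 1, row 2, and c, d the same for i + 1.
descent-step : ∀ a b c d → (T (a ∧ not b) → T (c ∨ d)) → ∀ i →
  [ (a ∧ not b ∨ b ∧ c) ∧ d ]· i + [ c ∧ not d ]· suc i
    ≡ [ b ∧ c ]· i + [ a ∧ not b ]· i + [ c ∧ not d ]· 1 + [ not (a ∨ b) ∧ c ∧ not d ]· i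
descent-step true  false false false stuck _ = ⊥-elim (stuck _)
descent-step true  true  true  true  _ i = sym (trans (+-identityʳ _) (+-identityʳ _))
descent-step true  true  true  false _ i = sym (trans (+-identityʳ _) (trans (+-comm (i + 0) 1) (cong suc (+-identityʳ i))))
descent-step true  true  false true  _ i = refl
descent-step true  true  false false _ i = refl
descent-step true  false true  true  _ i = sym (+-identityʳ _)
descent-step true  false true  false _ i = sym (trans (+-identityʳ _) (+-comm i 1))
descent-step true  false false true  _ i = sym (+-identityʳ _)
descent-step false true  true  true  _ i = sym (trans (+-identityʳ _) (+-identityʳ _))
descent-step false true  true  false _ i = sym (trans (+-identityʳ _) (trans (+-comm (i + 0) 1) (cong suc (+-identityʳ i))))
descent-step false true  false true  _ i = refl
descent-step false true  false false _ i = refl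
descent-step false false true  true  _ i = refl
descent-step false false true  false _ i = refl
descent-step false false false true  _ i = refl
descent-step false false false false _ i = refl

∑< : ℕ → (ℕ → ℕ) → ℕ
∑< zero    f = 0
∑< (suc N) f = ∑< N f + f N

infix 6.5 ∑<
syntax ∑< N (λ i → e) = ∑[ i < N ] e

module _ {f h : ℕ → ℕ} where

  ∑-cong : ∀ N → (∀ i → i < N → f i ≡ h i) → ∑< N f ≡ ∑< N h
  ∑-cong zero    _   = refl
  ∑-cong (suc N) f≡h = cong₂ _+_ (∑-cong N (λ i i<N → f≡h i (m<n⇒m<1+n i<N))) (f≡h N (n<1+n N))

  ∑-+ : ∀ N → ∑[ i < N ] (f i + h i) ≡ ∑< N f + ∑< N h
  ∑-+ zero    = refl
  ∑-+ (suc N) = trans (cong (_+ (f N + h N)) (∑-+ N)) (interchange (∑< N f) (∑< N h) (f N) (h N))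

∑-zero : ∀ {f} N → (∀ i → i < N → f i ≡ 0) → ∑< N f ≡ 0
∑-zero zero    _    = refl
∑-zero (suc N) f≡0 = cong₂ _+_ (∑-zero N (λ i i<N → f≡0 i (m<n⇒m<1+n i<N))) (f≡0 N (n<1+n N))

∑-single : ∀ {f} N {y} → y < N → (∀ i → i < N → i ≢ y → f i ≡ 0) → ∑< N f ≡ f y
∑-single {f} (suc N) {y} y<1+N others with m<1+n⇒m<n∨m≡n y<1+N
... | inj₂ refl = cong (_+ f N) (∑-zero N (λ i i<N → others i (m<n⇒m<1+n i<N) (<⇒≢ i<N)))
... | inj₁ y<N  = trans (cong₂ _+_ (∑-single N y<N (λ i i<N → others i (m<n⇒m<1+n i<N)))
                                   (others N (n<1+n N) (>⇒≢ y<N)))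
                        (+-identityʳ _)

∑-shift : ∀ f N → ∑[ i < N ] f (suc i) + f 0 ≡ ∑< N f + f N
∑-shift f zero    = refl
∑-shift f (suc N) = begin
  ∑[ i < N ] f (suc i) + f (suc N) + f 0  ≡⟨ xy∙z≈xz∙y _ (f (suc N)) (f 0) ⟩
  ∑[ i < N ] f (suc i) + f 0 + f (suc N)  ≡⟨ cong (_+ f (suc N)) (∑-shift f N) ⟩
  ∑< N f + f N + f (suc N)                ∎
  where open ≡-Reasoning

∑-rotate : ∀ {f} N → f 0 ≡ f N → ∑[ i < N ] f (suc i) ≡ ∑< N f
∑-rotate {f} N f0≡fN = +-cancelʳ-≡ (f 0) _ _ (trans (∑-shift f N) (cong (∑< N f +_) (sym f0≡fN)))

∑-count-above : ∀ m L → ∑[ i < suc (m + L) ] [ does (m <? i) ]· 1 ≡ L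
∑-count-above m zero    = ∑-zero (suc (m + 0)) λ i i≤m+0 →
  cong ([_]· 1) (dec-false (m <? i) (λ m<i → <⇒≱ m<i (subst (i ≤_) (+-identityʳ m) (s≤s⁻¹ i≤m+0))))
∑-count-above m (suc L) = begin
  ∑[ i < suc (m + suc L) ] [ does (m <? i) ]· 1    ≡⟨ cong (λ N → ∑[ i < suc N ] [ does (m <? i) ]· 1) (+-suc m L) ⟩
  ∑[ i < suc (suc (m + L)) ] [ does (m <? i) ]· 1  ≡⟨ cong₂ _+_ (∑-count-above m L) m<m+1+L ⟩
  L + 1                                            ≡⟨ +-comm L 1 ⟩
  suc L                                            ∎
  where
  open ≡-Reasoning
  m<m+1+L : [ does (m <? suc (m + L)) ]· 1 ≡ 1
  m<m+1+L = cong ([_]· 1) (dec-true (m <? suc (m + L)) (s≤s (m≤m+n m L)))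

sum-filter : ∀ {P : ℕ → Set} (P? : Decidable P) xs →
             sum (filter P? xs) ≡ sum (map (λ x → [ does (P? x) ]· x) xs)
sum-filter P? []       = refl
sum-filter P? (x ∷ xs) with does (P? x)
... | true  = cong (x +_) (sum-filter P? xs)
... | false = sum-filter P? xs

sum-map-unique : ∀ N (f : ℕ → ℕ) {ys} → Unique ys → All (_< N) ys →
                 sum (map f ys) ≡ ∑[ i < N ] [ does (i ∈? ys) ]· f i
sum-map-unique N f {[]}     []               []                = sym (∑-zero N (λ _ _ → refl))
sum-map-unique N f {y ∷ ys} (y∉ys ∷ unique) (y<N ∷ bounded) = begin
  f y + sum (map f ys)
    ≡⟨ cong₂ _+_ (sym ∑-at-y) (sum-map-unique N f unique bounded) ⟩
  ∑[ i < N ] [ does (i ≟ y) ]· f i + ∑[ i < N ] [ does (i ∈? ys) ]· f i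
    ≡⟨ sym (∑-+ N) ⟩
  ∑[ i < N ] ([ does (i ≟ y) ]· f i + [ does (i ∈? ys) ]· f i)
    ≡⟨ ∑-cong N (λ i _ → sym ([]·-∨-disjoint (f i) (disjoint i))) ⟩
  ∑[ i < N ] [ does (i ∈? y ∷ ys) ]· f i
    ∎
  where
  open ≡-Reasoning
  ∑-at-y : ∑[ i < N ] [ does (i ≟ y) ]· f i ≡ f y
  ∑-at-y = trans (∑-single N y<N (λ i _ i≢y → cong ([_]· f i) (dec-false (i ≟ y) i≢y)))
                 (cong ([_]· f y) (dec-true (y ≟ y) refl))
  disjoint : ∀ i → T (does (i ≟ y)) → T (does (i ∈? ys)) → ⊥
  disjoint i i≡y i∈ys = All.lookup y∉ys (does-sound (i ∈? ys) i∈ys) (sym (does-sound (i ≟ y) i≡y))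

sum-filter-deduplicate : ∀ N {P : ℕ → Set} (P? : Decidable P) {xs} → All (_< N) xs →
  sum (filter P? (deduplicate _≟_ xs)) ≡ ∑[ i < N ] [ does (i ∈? xs) ∧ does (P? i) ]· i
sum-filter-deduplicate N P? {xs} bounded = begin
  sum (filter P? xs′)                                 ≡⟨ sum-filter P? xs′ ⟩
  sum (map (λ x → [ does (P? x) ]· x) xs′)            ≡⟨ sum-map-unique N _ (deduplicate-! xs) bounded′ ⟩
  ∑[ i < N ] [ does (i ∈? xs′) ]· [ does (P? i) ]· i  ≡⟨ ∑-cong N (λ i _ → sym (bracket-deduplicate i)) ⟩
  ∑[ i < N ] [ does (i ∈? xs) ∧ does (P? i) ]· i      ∎
  where
  open ≡-Reasoning
  xs′ : List ℕ
  xs′ = deduplicate _≟_ xs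
  bounded′ : All (_< N) xs′
  bounded′ = All.tabulate (λ x∈xs′ → All.lookup bounded (∈-deduplicate⁻ _≟_ xs x∈xs′))
  bracket-deduplicate : ∀ i → [ does (i ∈? xs) ∧ does (P? i) ]· i ≡ [ does (i ∈? xs′) ]· [ does (P? i) ]· i
  bracket-deduplicate i = trans (cong (λ b → [ b ∧ does (P? i) ]· i) (does-⇔ (deduplicate-∈⇔ _≟_) (i ∈? xs) (i ∈? xs′)))
                   ([]·-∧ (does (i ∈? xs′)) (does (P? i)) i)

prevCyc-injective : ∀ {n} {i j : Fin n} → prevCyc i ≡ prevCyc j → i ≡ j
prevCyc-injective {i = zero}  {zero}  _  = refl
prevCyc-injective {i = zero}  {suc j} eq = ⊥-elim (fromℕ≢inject₁ eq)
prevCyc-injective {i = suc i} {zero}  eq = ⊥-elim (fromℕ≢inject₁ (sym eq))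
prevCyc-injective {i = suc i} {suc j} eq = cong suc (inject₁-injective eq)

module StrictlyIncreasing {n} (f : Fin (suc n) → ℕ) (f-strict : ∀ i j → i F.< j → f i < f j) where

  f-mono : ∀ {i j} → i F.≤ j → f i ≤ f j
  f-mono {i} {j} i≤j with m≤n⇒m<n∨m≡n i≤j
  ... | inj₁ i<j = <⇒≤ (f-strict i j i<j)
  ... | inj₂ i≡j = ≤-reflexive (cong f (toℕ-injective i≡j))

  f-reflects-< : ∀ {i j} → f i < f j → i F.< j
  f-reflects-< fi<fj = ≰⇒> (λ j≤i → <⇒≱ fi<fj (f-mono j≤i))

  f-injective : ∀ {i j} → f i ≡ f j → i ≡ j
  f-injective {i} {j} fi≡fj with <-cmp (toℕ i) (toℕ j)
  ... | tri< i<j _ _ = ⊥-elim (<-irrefl fi≡fj (f-strict i j i<j))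
  ... | tri≈ _ i≡j _ = toℕ-injective i≡j
  ... | tri> _ _ j<i = ⊥-elim (<-irrefl (sym fi≡fj) (f-strict j i j<i))

  f-≤-last : ∀ i → f i ≤ f (fromℕ n)
  f-≤-last i = f-mono (≤fromℕ i)

  f-suc⇒prevCyc : ∀ {t j} → f j ≡ suc (f t) → prevCyc j ≡ t
  f-suc⇒prevCyc {t} {zero} fj≡1+ft with f-reflects-< {t} {zero} (≤-reflexive (sym fj≡1+ft))
  ... | ()
  f-suc⇒prevCyc {t} {suc j} fj≡1+ft with <-cmp (toℕ t) (toℕ (inject₁ j))
  ... | tri≈ _ t≡j _ = sym (toℕ-injective t≡j)
  ... | tri< t<j _ _ = ⊥-elim (<⇒≱ (f-strict t (inject₁ j) t<j) (s≤s⁻¹ fj<1+ft))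
    where
    fj<1+ft : f (inject₁ j) < suc (f t)
    fj<1+ft = subst (f (inject₁ j) <_) fj≡1+ft (f-strict (inject₁ j) (suc j) (≤̄⇒inject₁< ≤-refl))
  ... | tri> _ _ j<t = ⊥-elim (<⇒≱ j<t (subst (toℕ t ≤_) (sym (toℕ-inject₁ j)) t≤j))
    where
    t≤j : toℕ t ≤ toℕ j
    t≤j = s≤s⁻¹ (f-reflects-< {t} {suc j} (≤-reflexive (sym fj≡1+ft)))

  f-suc∘prevCyc⇒≡ : ∀ {j j′} → f j′ ≡ suc (f (prevCyc j)) → j′ ≡ j
  f-suc∘prevCyc⇒≡ fj′≡1+fpj = prevCyc-injective (f-suc⇒prevCyc fj′≡1+fpj)

sum-map-const-1 : ∀ (xs : List ℕ) → sum (map (λ _ → 1) xs) ≡ length xs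
sum-map-const-1 []       = refl
sum-map-const-1 (x ∷ xs) = cong suc (sum-map-const-1 xs)

complement-count : ∀ c n k → c + suc n ≡ 2 * suc n ∸ k → c + k ≡ suc n
complement-count c n k c+n≡2n∸k with k ≤? 2 * suc n
... | yes k≤2n = +-cancelʳ-≡ (suc n) _ _ (begin
  c + k + suc n      ≡⟨ xy∙z≈xz∙y c k (suc n) ⟩
  c + suc n + k      ≡⟨ cong (_+ k) c+n≡2n∸k ⟩
  2 * suc n ∸ k + k  ≡⟨ m∸n+n≡m k≤2n ⟩
  2 * suc n          ≡⟨ cong (suc n +_) (+-identityʳ (suc n)) ⟩
  suc n + suc n      ∎)
  where open ≡-Reasoning
... | no k≰2n with () ← trans (sym (+-suc c n)) (trans c+n≡2n∸k (m≤n⇒m∸n≡0 (<⇒≤ (≰⇒> k≰2n))))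

cancel-and-substitute : ∀ x y f c e k n → x + f ≡ y + f + c + e → c + k ≡ n → x + k ≡ y + e + n
cancel-and-substitute x y f c e k n x+f≡ c+k≡n = +-cancelʳ-≡ f _ _ (begin
  x + k + f            ≡⟨ xy∙z≈xz∙y x k f ⟩
  x + f + k            ≡⟨ cong (_+ k) x+f≡ ⟩
  y + f + c + e + k    ≡⟨ regroup y f c e k ⟩
  y + e + (c + k) + f  ≡⟨ cong (λ z → y + e + z + f) c+k≡n ⟩
  y + e + n + f        ∎)
  where
  open ≡-Reasoning
  regroup : ∀ y f c e k → y + f + c + e + k ≡ y + e + (c + k) + f
  regroup = solve-∀

-- The array has suc n columns: the n of the paper is suc n here.
module RIncProperties (m k n : ℕ) (T : Array (suc n)) (rinc : RInc m k (suc n) T) where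

  open RInc rinc
  private
    module Row₁ = StrictlyIncreasing (row1 T) row1-strict
    module Row₂ = StrictlyIncreasing (row2 T) row2-strict

  M N : ℕ
  M = m + (2 * suc n ∸ k)
  N = suc M

  r₁ r₂ g₁ : List ℕ
  r₁ = rowList1 T
  r₂ = rowList2 T
  g₁ = proj₁ (g T)

  row1∈r₁ : ∀ j → row1 T j ∈ r₁
  row1∈r₁ = ∈-tabulate⁺ {f = row1 T}

  row2∈r₂ : ∀ j → row2 T j ∈ r₂
  row2∈r₂ = ∈-tabulate⁺ {f = row2 T}

  onlyRow1? : ∀ x → Dec (x ∈ r₁ × x ∉ r₂)
  onlyRow1? x = x ∈? r₁ ×-dec ¬? (x ∈? r₂)

  occurs? : ∀ x → Dec (x ∈ r₁ ⊎ x ∈ r₂)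
  occurs? x = x ∈? r₁ ⊎-dec x ∈? r₂

  in₁ in₂ onlyRow1 : ℕ → Bool
  in₁ x = does (x ∈? r₁)
  in₂ x = does (x ∈? r₂)
  onlyRow1 x = does (onlyRow1? x)

  ∈-rows⇔range : ∀ {x} → (x ∈ r₁ ⊎ x ∈ r₂) ⇔ (m < x × x ≤ M)
  ∈-rows⇔range {x} = mk⇔ (to (entries x) ∘ occurs) (rows ∘ from (entries x))
    where
    occurs : x ∈ r₁ ⊎ x ∈ r₂ → Occurs T x
    occurs (inj₁ x∈r₁) with j , refl ← ∈-tabulate⁻ {f = row1 T} x∈r₁ = zero , j , refl
    occurs (inj₂ x∈r₂) with j , refl ← ∈-tabulate⁻ {f = row2 T} x∈r₂ = suc zero , j , refl
    rows : Occurs T x → x ∈ r₁ ⊎ x ∈ r₂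
    rows (zero     , j , refl) = inj₁ (row1∈r₁ j)
    rows (suc zero , j , refl) = inj₂ (row2∈r₂ j)

  in-range : ∀ {x} → x ∈ r₁ ⊎ x ∈ r₂ → m < x × x ≤ M
  in-range = to ∈-rows⇔range

  onlyRow1-outside : ∀ {x} → ¬ (m < x × x ≤ M) → onlyRow1 x ≡ false
  onlyRow1-outside {x} x∉range = dec-false (onlyRow1? x) (x∉range ∘ in-range ∘ inj₁ ∘ proj₁)

  row2-bounded : All (_< N) r₂
  row2-bounded = All.tabulate (λ x∈r₂ → s≤s (proj₂ (in-range (inj₂ x∈r₂))))

  row1-first : row1 T zero ≡ suc m
  row1-first = ≤-antisym (entry-≤ (from ∈-rows⇔range (n<1+n m , 1+m≤M))) m<r₁₀
    where
    m<r₁₀ : m < row1 T zero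
    m<r₁₀ = proj₁ (in-range (inj₁ (row1∈r₁ zero)))
    1+m≤M : suc m ≤ M
    1+m≤M = ≤-trans m<r₁₀ (proj₂ (in-range (inj₁ (row1∈r₁ zero))))
    entry-≤ : ∀ {x} → x ∈ r₁ ⊎ x ∈ r₂ → row1 T zero ≤ x
    entry-≤ (inj₁ x∈r₁) with j , refl ← ∈-tabulate⁻ {f = row1 T} x∈r₁ = Row₁.f-mono z≤n
    entry-≤ (inj₂ x∈r₂) with j , refl ← ∈-tabulate⁻ {f = row2 T} x∈r₂ = ≤-trans (col-weak zero) (Row₂.f-mono z≤n)

  ∈-setA : ∀ {x} → x ∈ setA T ⇔ (x ∈ r₂ × x ∈ r₁)
  ∈-setA = mk⇔ (∈-filter⁻ (_∈? r₁)) (uncurry (∈-filter⁺ (_∈? r₁)))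

  private
    B-entry : Fin (suc n) → ℕ
    B-entry j = row2 T (prevCyc j)

    heads-in-A? : ∀ j → Dec (row2 T j ∈ setA T)
    heads-in-A? j = row2 T j ∈? setA T

  setB⊆row2 : ∀ {x} → x ∈ setB T → x ∈ r₂
  setB⊆row2 x∈B with j , _ , refl , _ ← ∈-map∘filter⁻ B-entry heads-in-A? {xs = allFin (suc n)} x∈B =
    row2∈r₂ (prevCyc j)

  -- As suc x lies in row 2, x is not the last entry of row 2, so the cyclic wrap-around in B is harmless.
  ∈-setB : ∀ {x} → suc x ∈ r₂ → x ∈ setB T ⇔ (x ∈ r₂ × suc x ∈ setA T)
  ∈-setB {x} 1+x∈r₂ = mk⇔ to′ from′
    where
    to′ : x ∈ setB T → x ∈ r₂ × suc x ∈ setA T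
    to′ x∈B with j , _ , refl , head∈A ← ∈-map∘filter⁻ B-entry heads-in-A? {xs = allFin (suc n)} x∈B
               | j′ , 1+x≡ ← ∈-tabulate⁻ {f = row2 T} 1+x∈r₂
               with refl ← Row₂.f-suc∘prevCyc⇒≡ {j} {j′} (sym 1+x≡) =
      row2∈r₂ (prevCyc j) , subst (_∈ setA T) (sym 1+x≡) head∈A
    from′ : x ∈ r₂ × suc x ∈ setA T → x ∈ setB T
    from′ (x∈r₂ , 1+x∈A) with t , refl ← ∈-tabulate⁻ {f = row2 T} x∈r₂ | j , 1+x≡ ← ∈-tabulate⁻ {f = row2 T} 1+x∈r₂ =
      ∈-map∘filter⁺ B-entry heads-in-A? {xs = allFin (suc n)}
        (j , ∈-allFin j , cong (row2 T) (sym (Row₂.f-suc⇒prevCyc (sym 1+x≡))) , subst (_∈ setA T) 1+x≡ 1+x∈A)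

  ∈-g₁ : ∀ {x} → x ∈ g₁ ⇔ ((x ∈ r₁ × x ∉ setA T) ⊎ x ∈ setB T)
  ∈-g₁ {x} = mk⇔ to′ from′
    where
    notA? : ∀ y → Dec (y ∉ setA T)
    notA? y = ¬? (y ∈? setA T)
    unsorted : List ℕ
    unsorted = filter notA? r₁ ++ setB T
    to′ : x ∈ g₁ → (x ∈ r₁ × x ∉ setA T) ⊎ x ∈ setB T
    to′ x∈g₁ with ∈-++⁻ (filter notA? r₁) (∈-resp-↭ (sort-↭ unsorted) x∈g₁)
    ... | inj₁ x∈r₁∖A = inj₁ (∈-filter⁻ notA? x∈r₁∖A)
    ... | inj₂ x∈B    = inj₂ x∈B
    from′ : (x ∈ r₁ × x ∉ setA T) ⊎ x ∈ setB T → x ∈ g₁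
    from′ (inj₁ (x∈r₁ , x∉A)) = ∈-resp-↭ (↭-sym (sort-↭ unsorted)) (∈-++⁺ˡ (∈-filter⁺ notA? x∈r₁ x∉A))
    from′ (inj₂ x∈B)          = ∈-resp-↭ (↭-sym (sort-↭ unsorted)) (∈-++⁺ʳ (filter notA? r₁) x∈B)

  g₁-bounded : All (_< N) g₁
  g₁-bounded = All.tabulate λ x∈g₁ → s≤s (proj₂ (in-range (rows (to ∈-g₁ x∈g₁))))
    where
    rows : ∀ {x} → (x ∈ r₁ × x ∉ setA T) ⊎ x ∈ setB T → x ∈ r₁ ⊎ x ∈ r₂
    rows (inj₁ (x∈r₁ , _)) = inj₁ x∈r₁
    rows (inj₂ x∈B)        = inj₂ (setB⊆row2 x∈B)

  ∈-g₁-if-suc∈r₂ : ∀ {i} → suc i ∈ r₂ → i ∈ g₁ ⇔ ((i ∈ r₁ × i ∉ r₂) ⊎ (i ∈ r₂ × suc i ∈ r₁))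
  ∈-g₁-if-suc∈r₂ {i} 1+i∈r₂ = mk⇔ to′ from′
    where
    to′ : i ∈ g₁ → (i ∈ r₁ × i ∉ r₂) ⊎ (i ∈ r₂ × suc i ∈ r₁)
    to′ i∈g₁ with to ∈-g₁ i∈g₁
    ... | inj₁ (i∈r₁ , i∉A) = inj₁ (i∈r₁ , λ i∈r₂ → i∉A (from ∈-setA (i∈r₂ , i∈r₁)))
    ... | inj₂ i∈B with i∈r₂ , 1+i∈A ← to (∈-setB 1+i∈r₂) i∈B = inj₂ (i∈r₂ , proj₂ (to ∈-setA 1+i∈A))
    from′ : (i ∈ r₁ × i ∉ r₂) ⊎ (i ∈ r₂ × suc i ∈ r₁) → i ∈ g₁
    from′ (inj₁ (i∈r₁ , i∉r₂)) = from ∈-g₁ (inj₁ (i∈r₁ , i∉r₂ ∘ proj₁ ∘ to ∈-setA))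
    from′ (inj₂ (i∈r₂ , 1+i∈r₁)) = from ∈-g₁ (inj₂ (from (∈-setB 1+i∈r₂) (i∈r₂ , from ∈-setA (1+i∈r₂ , 1+i∈r₁))))

  maj-g : maj (g T) ≡ ∑[ i < N ] [ (onlyRow1 i ∨ in₂ i ∧ in₁ (suc i)) ∧ in₂ (suc i) ]· i
  maj-g = trans (sum-filter-deduplicate (N) (λ i → suc i ∈? r₂) g₁-bounded)
                (∑-cong (N) λ i _ → cong ([_]· i) (∧-congʳ-T (in₂ (suc i)) λ 1+i∈r₂ →
                  does-⇔ (∈-g₁-if-suc∈r₂ (does-sound (suc i ∈? r₂) 1+i∈r₂))
                         (i ∈? g₁) (onlyRow1? i ⊎-dec (i ∈? r₂ ×-dec suc i ∈? r₁))))

  amaj-T : amaj (toTwoRow T) ≡ ∑[ i < N ] [ in₂ i ∧ in₁ (suc i) ]· i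
  amaj-T = sum-filter-deduplicate (N) (λ i → suc i ∈? r₁) row2-bounded

  row1∖row2-< : ∀ {x} → x ∈ r₁ → x ∉ r₂ → x < M
  row1∖row2-< x∈r₁ x∉r₂ with j , refl ← ∈-tabulate⁻ {f = row1 T} x∈r₁ =
    <-≤-trans (≤∧≢⇒< (≤-trans (col-weak j) (Row₂.f-≤-last j)) r₁ⱼ≢last) (proj₂ (in-range (inj₂ (row2∈r₂ (fromℕ n)))))
    where
    r₁ⱼ≢last : row1 T j ≢ row2 T (fromℕ n)
    r₁ⱼ≢last r₁ⱼ≡last = x∉r₂ (subst (_∈ r₂) (sym r₁ⱼ≡last) (row2∈r₂ (fromℕ n)))

  onlyRow1-successor : ∀ i → Bool.T (onlyRow1 i) → Bool.T (in₁ (suc i) ∨ in₂ (suc i))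
  onlyRow1-successor i only with i∈r₁ , i∉r₂ ← does-sound (onlyRow1? i) only =
    does-complete (occurs? (suc i)) (from ∈-rows⇔range (m<n⇒m<1+n (proj₁ (in-range (inj₁ i∈r₁))) , row1∖row2-< i∈r₁ i∉r₂))

  onlyRow1-count : ∑[ i < N ] [ onlyRow1 i ]· 1 + k ≡ suc n
  onlyRow1-count = complement-count _ n k (begin
    ∑[ i < N ] [ onlyRow1 i ]· 1 + suc n
      ≡⟨ cong (∑[ i < N ] [ onlyRow1 i ]· 1 +_) (sym row2-count) ⟩
    ∑[ i < N ] [ onlyRow1 i ]· 1 + ∑[ i < N ] [ in₂ i ]· 1
      ≡⟨ sym (∑-+ (N)) ⟩
    ∑[ i < N ] ([ onlyRow1 i ]· 1 + [ in₂ i ]· 1)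
      ≡⟨ ∑-cong (N) (λ i _ → []·1-∨-split (in₁ i) (in₂ i)) ⟩
    ∑[ i < N ] [ in₁ i ∨ in₂ i ]· 1
      ≡⟨ ∑-cong (N) (λ i i<1+M → cong ([_]· 1) (does-⇔ (occurs⇔above i<1+M) (occurs? i) (m <? i))) ⟩
    ∑[ i < N ] [ does (m <? i) ]· 1
      ≡⟨ ∑-count-above m (2 * suc n ∸ k) ⟩
    2 * suc n ∸ k
      ∎)
    where
    open ≡-Reasoning
    row2-count : ∑[ i < N ] [ in₂ i ]· 1 ≡ suc n
    row2-count = begin
      ∑[ i < N ] [ in₂ i ]· 1  ≡⟨ sym (sum-map-unique (N) (λ _ → 1) (tabulate⁺ Row₂.f-injective) row2-bounded) ⟩
      sum (map (λ _ → 1) r₂)       ≡⟨ sum-map-const-1 r₂ ⟩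
      length r₂                    ≡⟨ length-tabulate (row2 T) ⟩
      suc n                        ∎
    occurs⇔above : ∀ {i} → i < N → (i ∈ r₁ ⊎ i ∈ r₂) ⇔ m < i
    occurs⇔above i<1+M = mk⇔ (proj₁ ∘ in-range) (λ m<i → from ∈-rows⇔range (m<i , s≤s⁻¹ i<1+M))

  first-entries : ∑[ i < N ] [ not (in₁ i ∨ in₂ i) ∧ onlyRow1 (suc i) ]· i ≡ [ onlyRow1 (suc m) ]· m
  first-entries = trans (∑-single (N) (s≤s (m≤m+n m _)) vanish)
                        (cong (λ b → [ not b ∧ onlyRow1 (suc m) ]· m) (dec-false (occurs? m) (n≮n m ∘ proj₁ ∘ in-range)))
    where
    vanish : ∀ i → i < N → i ≢ m → [ not (in₁ i ∨ in₂ i) ∧ onlyRow1 (suc i) ]· i ≡ 0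
    vanish i _ i≢m = []·-not-∧-vanish i λ only →
      let m<1+i , 1+i≤M = in-range (inj₁ (proj₁ (does-sound (onlyRow1? (suc i)) only))) in
      does-complete (occurs? i) (from ∈-rows⇔range (≤∧≢⇒< (s≤s⁻¹ m<1+i) (i≢m ∘ sym) , <⇒≤ 1+i≤M))

  first-column-equal : row1 T zero ≡ row2 T zero → onlyRow1 (suc m) ≡ false
  first-column-equal r₁₀≡r₂₀ = dec-false (onlyRow1? (suc m)) λ (_ , 1+m∉r₂) →
    1+m∉r₂ (subst (_∈ r₂) (trans (sym r₁₀≡r₂₀) row1-first) (row2∈r₂ zero))

  first-column-distinct : row1 T zero ≢ row2 T zero → onlyRow1 (suc m) ≡ true
  first-column-distinct r₁₀≢r₂₀ = dec-true (onlyRow1? (suc m)) (subst (_∈ r₁) row1-first (row1∈r₁ zero) , 1+m∉r₂)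
    where
    1+m∉r₂ : suc m ∉ r₂
    1+m∉r₂ 1+m∈r₂ with j , 1+m≡r₂ⱼ ← ∈-tabulate⁻ {f = row2 T} 1+m∈r₂ =
      r₁₀≢r₂₀ (≤-antisym (col-weak zero) (≤-trans (Row₂.f-mono z≤n) (≤-reflexive (sym (trans row1-first 1+m≡r₂ⱼ)))))

  maj-g-amaj-difference : maj (g T) + k ≡ amaj (toTwoRow T) + [ onlyRow1 (suc m) ]· m + suc n
  maj-g-amaj-difference = cancel-and-substitute (maj (g T)) (amaj (toTwoRow T)) (∑< N S) (∑< N S₁) _ k (suc n) (begin
    maj (g T) + ∑< N S
      ≡⟨ cong₂ _+_ maj-g (sym (∑-rotate N (trans ([]·-zeroʳ (onlyRow1 0)) (sym S-at-N)))) ⟩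
    ∑[ i < N ] D i + ∑[ i < N ] S (suc i)
      ≡⟨ sym (∑-+ N) ⟩
    ∑[ i < N ] (D i + S (suc i))
      ≡⟨ ∑-cong N (λ i _ → descent-step (in₁ i) (in₂ i) (in₁ (suc i)) (in₂ (suc i)) (onlyRow1-successor i) i) ⟩
    ∑[ i < N ] (A i + S i + S₁ (suc i) + E i)
      ≡⟨ trans (∑-+ N) (cong (_+ ∑< N E) (trans (∑-+ N) (cong (_+ ∑[ i < N ] S₁ (suc i)) (∑-+ N)))) ⟩
    ∑< N A + ∑< N S + ∑[ i < N ] S₁ (suc i) + ∑< N E
      ≡⟨ cong₂ (λ a c → a + ∑< N S + c + ∑< N E) (sym amaj-T) (∑-rotate N (trans S₁-at-0 (sym S₁-at-N))) ⟩
    amaj (toTwoRow T) + ∑< N S + ∑< N S₁ + ∑< N E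
      ≡⟨ cong (amaj (toTwoRow T) + ∑< N S + ∑< N S₁ +_) first-entries ⟩
    amaj (toTwoRow T) + ∑< N S + ∑< N S₁ + [ onlyRow1 (suc m) ]· m
      ∎) onlyRow1-count
    where
    open ≡-Reasoning
    D A S S₁ E : ℕ → ℕ
    D i = [ (onlyRow1 i ∨ in₂ i ∧ in₁ (suc i)) ∧ in₂ (suc i) ]· i
    A i = [ in₂ i ∧ in₁ (suc i) ]· i
    S i = [ onlyRow1 i ]· i
    S₁ i = [ onlyRow1 i ]· 1
    E i = [ not (in₁ i ∨ in₂ i) ∧ onlyRow1 (suc i) ]· i
    S-at-N : S N ≡ 0
    S-at-N = cong ([_]· N) (onlyRow1-outside {N} (n≮n M ∘ proj₂))
    S₁-at-N : S₁ N ≡ 0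
    S₁-at-N = cong ([_]· 1) (onlyRow1-outside {N} (n≮n M ∘ proj₂))
    S₁-at-0 : S₁ 0 ≡ 0
    S₁-at-0 = cong ([_]· 1) (onlyRow1-outside {0} (λ { (() , _) }))

proposition3p2 : (n m k : ℕ) (n≥1 : 1 ≤ n) (T : Array n) → PRInc m k n T →
    (row1 T (firstCol n≥1) ≡ row2 T (firstCol n≥1) →
       maj (g T) + k ≡ amaj (toTwoRow T) + n)
    × (row1 T (firstCol n≥1) ≢ row2 T (firstCol n≥1) →
       maj (g T) + k ≡ amaj (toTwoRow T) + m + n)
proposition3p2 (suc n) m k (s≤s z≤n) T pr = equal-first-column , distinct-first-column
  where
  open RIncProperties m k n T (PRInc.rinc pr)
  open ≡-Reasoning
  equal-first-column : row1 T zero ≡ row2 T zero → maj (g T) + k ≡ amaj (toTwoRow T) + suc n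
  equal-first-column r₁₀≡r₂₀ = begin
    maj (g T) + k                                          ≡⟨ maj-g-amaj-difference ⟩
    amaj (toTwoRow T) + [ onlyRow1 (suc m) ]· m + suc n  ≡⟨ cong (λ b → amaj (toTwoRow T) + [ b ]· m + suc n) (first-column-equal r₁₀≡r₂₀) ⟩
    amaj (toTwoRow T) + 0 + suc n                          ≡⟨ cong (_+ suc n) (+-identityʳ _) ⟩
    amaj (toTwoRow T) + suc n                              ∎
  distinct-first-column : row1 T zero ≢ row2 T zero → maj (g T) + k ≡ amaj (toTwoRow T) + m + suc n
  distinct-first-column r₁₀≢r₂₀ = begin
    maj (g T) + k                                          ≡⟨ maj-g-amaj-difference ⟩
    amaj (toTwoRow T) + [ onlyRow1 (suc m) ]· m + suc n  ≡⟨ cong (λ b → amaj (toTwoRow T) + [ b ]· m + suc n) (first-column-distinct r₁₀≢r₂₀) ⟩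
    amaj (toTwoRow T) + m + suc n                          ∎
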